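{- Let $H$ be a finite graph with adjacency matrix $A_H$, and suppose $A_H$ is invertible. Let $k\geq 1$, put $\tilde{A}_H=I_k\otimes A_H$, and let $P$ be a permutation matrix of size $k|V_H|$ such that $\tilde{A}_HP\tilde{A}_H$ is symmetric. Then $P$ is symmetric, i.e. $P^T=P$ (equivalently, the associated permutation $p$ satisfies $p^2=\mathrm{id}$). In other words, every permutational power of $H$ is a zig-zag product.
   Context: Graphs are finite and undirected; loops and multiple edges are allowed. The adjacency matrix $A_H=(a_{u,v})$ has $a_{u,v}$ equal to the number of edges joining $u$ and $v$. For $k\geq1$, $\tilde{A}_H=I_k\otimes A_H$ is the adjacency matrix of $k$ disjoint copies of $H$. If $p\in Sym(k|V_H|)$ has permutation matrix $P$ and $\tilde{A}_HP\tilde{A}_H$ is symmetric, the graph with adjacency matrix $\tilde{A}_HP\tilde{A}_H$ is called the permutational $k$-th power of $H$ with respect to $p$. Such a power is called a (classical) zig-zag product when it arises from a symmetric permutation matrix, i.e. from a permutation $p$ with $p^2=\mathrm{id}$. -}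

module Defs where

open import Data.Nat using (ℕ; zero; suc; _+_; _*_)
open import Data.Fin using (Fin; zero; suc; remQuot)
open import Data.Fin.Permutation using (Permutation′; _⟨$⟩ʳ_)
open import Data.Product using (_×_; _,_; ∃)
open import Data.Bool using (if_then_else_)
open import Relation.Nullary.Decidable using (⌊_⌋)
import Data.Fin as F
open import Relation.Binary.PropositionalEquality using (_≡_)
import Data.Rational as Q
import Data.Integer as Z

Mat : Set → ℕ → Set
Mat A m = Fin m → Fin m → A

sumℕ : ∀ {m} → (Fin m → ℕ) → ℕ
sumℕ {zero}  f = 0
sumℕ {suc m} f = f zero + sumℕ (λ i → f (suc i))

sumℚ : ∀ {m} → (Fin m → Q.ℚ) → Q.ℚ
sumℚ {zero}  f = Q.0ℚ
sumℚ {suc m} f = f zero Q.+ sumℚ (λ i → f (suc i))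

_·_ : ∀ {m} → Mat ℕ m → Mat ℕ m → Mat ℕ m
(M · N) i j = sumℕ (λ l → M i l * N l j)

_·ℚ_ : ∀ {m} → Mat Q.ℚ m → Mat Q.ℚ m → Mat Q.ℚ m
(M ·ℚ N) i j = sumℚ (λ l → M i l Q.* N l j)

identityℚ : ∀ {m} → Mat Q.ℚ m
identityℚ i j = if ⌊ i F.≟ j ⌋ then Q.1ℚ else Q.0ℚ

transpose : ∀ {A m} → Mat A m → Mat A m
transpose M i j = M j i

Symmetric : ∀ {A m} → Mat A m → Set
Symmetric M = ∀ i j → M i j ≡ M j i

-- A finite (multi)graph with loops on vertex set Fin n, given by its
-- adjacency matrix: a symmetric ℕ-valued matrix (a u v = number of edges u–v).
record Graph (n : ℕ) : Set where
  field
    adj    : Mat ℕ n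
    adjSym : Symmetric adj

toℚ : ∀ {m} → Mat ℕ m → Mat Q.ℚ m
toℚ M i j = Z.+ (M i j) Q./ 1

-- invertibility of a natural-number matrix, over the rationals (equivalently reals)
Invertible : ∀ {m} → Mat ℕ m → Set
Invertible {m} M = ∃ λ (B : Mat Q.ℚ m) →
  (∀ i j → (toℚ M ·ℚ B) i j ≡ identityℚ i j) × (∀ i j → (B ·ℚ toℚ M) i j ≡ identityℚ i j)

-- Kronecker product I_k ⊗ A, indices of Fin (k * n) read as pairs (block, vertex)
blockDiag : (k : ℕ) {n : ℕ} → Mat ℕ n → Mat ℕ (k * n)
blockDiag k {n} A x y with remQuot {k} n x | remQuot {k} n y
... | (b , u) | (c , v) = if ⌊ b F.≟ c ⌋ then A u v else 0

permMatrix : ∀ {m} → Permutation′ m → Mat ℕ m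
permMatrix p i j = if ⌊ p ⟨$⟩ʳ i F.≟ j ⌋ then 1 else 0

module Submission where

-- Split P into n×n blocks P_bd (b, d : Fin k).  Since Ã is block
-- diagonal, the (b,d) block of Ã P Ã is A P_bd A.  Symmetry of Ã P Ã says
-- that the (b,d) block equals the transpose of the (d,b) block, i.e.
-- A P_bd A = (A P_db A)ᵀ = A P_dbᵀ A (A is symmetric, being an adjacency
-- matrix).  Cancelling the invertible A on both sides gives P_bd = P_dbᵀ,
-- which is exactly the symmetry of P; a symmetric permutation matrix
-- belongs to an involution.

open import Defs
open import Data.Nat using (ℕ; _*_; _≥_)
open import Data.Fin.Permutation using (Permutation′; _⟨$⟩ʳ_)
open import Relation.Binary.PropositionalEquality using (_≡_)
open import Data.Product using (_×_)

open import Data.Nat using (zero; suc)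
import Data.Nat as ℕ
open import Data.Integer using (+_)
import Data.Integer.Properties as ℤP
open import Data.Rational using (ℚ; mkℚ; 0ℚ; 1ℚ)
import Data.Rational as ℚ
import Data.Rational.Properties as ℚP
import Data.Rational.Unnormalised as ℚᵘ
import Data.Rational.Unnormalised.Properties as ℚᵘP
import Data.Nat.Coprimality as Coprimality
open import Data.Fin using (Fin; zero; suc; _↑ˡ_; _↑ʳ_; combine; remQuot; _≟_)
import Data.Fin.Properties as FinP
open import Data.Product using (_,_; proj₁; proj₂)
open import Data.Bool using (if_then_else_)
open import Relation.Nullary.Decidable using (Dec; ⌊_⌋; yes; no)
open import Data.Empty using (⊥-elim)
open import Algebra.Bundles using (CommutativeRing)
open import Relation.Binary.Bundles using (Setoid)
open import Level using (0ℓ)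
open import Relation.Binary.PropositionalEquality
  using (refl; sym; trans; cong; cong₂; subst₂; module ≡-Reasoning)
import Relation.Binary.Reasoning.Setoid as SetoidReasoning
open import Algebra.Properties.Semiring.Sum
  (CommutativeRing.semiring ℚP.+-*-commutativeRing)
  using (sum; sum-cong-≗; ∑-comm; *-distribˡ-sum; *-distribʳ-sum; sum-replicate-zero)

ι : ℕ → ℚ
ι m = + m ℚ./ 1

ι-mkℚ : ∀ m → ι m ≡ mkℚ (+ m) 0 (Coprimality.sym (Coprimality.1-coprimeTo m))
ι-mkℚ m = ℚP.↥p/↧p≡p (mkℚ (+ m) 0 (Coprimality.sym (Coprimality.1-coprimeTo m)))

ι-toℚᵘ : ∀ m → ℚ.toℚᵘ (ι m) ≡ ℚᵘ.mkℚᵘ (+ m) 0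
ι-toℚᵘ m = cong ℚ.toℚᵘ (ι-mkℚ m)

-- ι is additive; checked on unnormalised representatives.
ι-+ : ∀ a b → ι (a ℕ.+ b) ≡ ι a ℚ.+ ι b
ι-+ a b = ℚP.toℚᵘ-injective
  (ℚᵘP.≃-trans (ℚᵘP.≃-reflexive unnormalised) (ℚᵘP.≃-sym (ℚP.toℚᵘ-homo-+ (ι a) (ι b))))
  where
  unnormalised : ℚ.toℚᵘ (ι (a ℕ.+ b)) ≡ ℚ.toℚᵘ (ι a) ℚᵘ.+ ℚ.toℚᵘ (ι b)
  unnormalised rewrite ι-toℚᵘ a | ι-toℚᵘ b | ι-toℚᵘ (a ℕ.+ b)
                     | ℤP.*-identityʳ (+ a) | ℤP.*-identityʳ (+ b) = refl

ι-* : ∀ a b → ι (a ℕ.* b) ≡ ι a ℚ.* ι b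
ι-* a b = ℚP.toℚᵘ-injective
  (ℚᵘP.≃-trans (ℚᵘP.≃-reflexive unnormalised) (ℚᵘP.≃-sym (ℚP.toℚᵘ-homo-* (ι a) (ι b))))
  where
  unnormalised : ℚ.toℚᵘ (ι (a ℕ.* b)) ≡ ℚ.toℚᵘ (ι a) ℚᵘ.* ℚ.toℚᵘ (ι b)
  unnormalised rewrite ι-toℚᵘ a | ι-toℚᵘ b | ι-toℚᵘ (a ℕ.* b) | ℤP.+◃n≡+n (a ℕ.* b) = refl

-- ι is injective: the numerator recovers m.
ι-injective : ∀ a b → ι a ≡ ι b → a ≡ b
ι-injective a b eq = ℤP.+-injective (cong ℚ.↥_ (trans (sym (ι-mkℚ a)) (trans eq (ι-mkℚ b))))

-- `sumℚ` is the library's finite sum over the semiring ℚ, so its laws apply.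
sumℚ≡sum : ∀ {m} (f : Fin m → ℚ) → sumℚ f ≡ sum f
sumℚ≡sum {zero}  f = refl
sumℚ≡sum {suc m} f = cong (f zero ℚ.+_) (sumℚ≡sum (λ i → f (suc i)))

sumℚ-cong : ∀ {m} {f g : Fin m → ℚ} → (∀ i → f i ≡ g i) → sumℚ f ≡ sumℚ g
sumℚ-cong {f = f} {g} f≗g = begin
  sumℚ f ≡⟨ sumℚ≡sum f ⟩
  sum f  ≡⟨ sum-cong-≗ f≗g ⟩
  sum g  ≡⟨ sumℚ≡sum g ⟨
  sumℚ g ∎
  where open ≡-Reasoning

sumℚ-comm : ∀ {m n} (f : Fin m → Fin n → ℚ) →
  sumℚ (λ i → sumℚ (λ j → f i j)) ≡ sumℚ (λ j → sumℚ (λ i → f i j))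
sumℚ-comm f = begin
  sumℚ (λ i → sumℚ (f i))               ≡⟨ sumℚ-cong (λ i → sumℚ≡sum (f i)) ⟩
  sumℚ (λ i → sum (f i))                ≡⟨ sumℚ≡sum (λ i → sum (f i)) ⟩
  sum (λ i → sum (f i))                 ≡⟨ ∑-comm f ⟩
  sum (λ j → sum (λ i → f i j))         ≡⟨ sumℚ≡sum (λ j → sum (λ i → f i j)) ⟨
  sumℚ (λ j → sum (λ i → f i j))        ≡⟨ sumℚ-cong (λ j → sumℚ≡sum (λ i → f i j)) ⟨
  sumℚ (λ j → sumℚ (λ i → f i j))       ∎
  where open ≡-Reasoning

*-distribˡ-sumℚ : ∀ {m} x (f : Fin m → ℚ) → x ℚ.* sumℚ f ≡ sumℚ (λ i → x ℚ.* f i)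
*-distribˡ-sumℚ x f = trans (cong (x ℚ.*_) (sumℚ≡sum f))
  (trans (*-distribˡ-sum x f) (sym (sumℚ≡sum (λ i → x ℚ.* f i))))

*-distribʳ-sumℚ : ∀ {m} x (f : Fin m → ℚ) → sumℚ f ℚ.* x ≡ sumℚ (λ i → f i ℚ.* x)
*-distribʳ-sumℚ x f = trans (cong (ℚ._* x) (sumℚ≡sum f))
  (trans (*-distribʳ-sum x f) (sym (sumℚ≡sum (λ i → f i ℚ.* x))))

sumℚ-zero : ∀ m → sumℚ {m} (λ _ → 0ℚ) ≡ 0ℚ
sumℚ-zero m = trans (sumℚ≡sum {m} (λ _ → 0ℚ)) (sum-replicate-zero m)

sumℚ-++ : ∀ m n (f : Fin (m ℕ.+ n) → ℚ) →
  sumℚ f ≡ sumℚ (λ i → f (i ↑ˡ n)) ℚ.+ sumℚ (λ j → f (m ↑ʳ j))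
sumℚ-++ zero    n f = sym (ℚP.+-identityˡ (sumℚ f))
sumℚ-++ (suc m) n f = trans (cong (f zero ℚ.+_) (sumℚ-++ m n (λ i → f (suc i))))
  (sym (ℚP.+-assoc (f zero) _ _))

sumℚ-combine : ∀ k n (f : Fin (k * n) → ℚ) →
  sumℚ f ≡ sumℚ {k} (λ b → sumℚ {n} (λ u → f (combine b u)))
sumℚ-combine zero    n f = refl
sumℚ-combine (suc k) n f = trans (sumℚ-++ n (k * n) f)
  (cong (sumℚ (λ u → f (u ↑ˡ (k * n))) ℚ.+_) (sumℚ-combine k n (λ j → f (n ↑ʳ j))))

identityℚ-suc : ∀ {m} (i j : Fin m) → identityℚ (suc i) (suc j) ≡ identityℚ i j
identityℚ-suc i j with i ≟ j
... | yes _ = refl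
... | no  _ = refl

identityℚ-sym : ∀ {m} (i j : Fin m) → identityℚ i j ≡ identityℚ j i
identityℚ-sym i j with i ≟ j | j ≟ i
... | yes _   | yes _   = refl
... | yes i≡j | no  j≢i = ⊥-elim (j≢i (sym i≡j))
... | no  i≢j | yes j≡i = ⊥-elim (i≢j (sym j≡i))
... | no  _   | no  _   = refl

sumℚ-selectˡ : ∀ {m} (i : Fin m) (f : Fin m → ℚ) → sumℚ (λ j → identityℚ i j ℚ.* f j) ≡ f i
sumℚ-selectˡ {suc m} zero f = begin
  1ℚ ℚ.* f zero ℚ.+ sumℚ (λ j → 0ℚ ℚ.* f (suc j))
    ≡⟨ cong₂ ℚ._+_ (ℚP.*-identityˡ (f zero)) (sumℚ-cong (λ j → ℚP.*-zeroˡ (f (suc j)))) ⟩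
  f zero ℚ.+ sumℚ {m} (λ _ → 0ℚ) ≡⟨ cong (f zero ℚ.+_) (sumℚ-zero m) ⟩
  f zero ℚ.+ 0ℚ                  ≡⟨ ℚP.+-identityʳ (f zero) ⟩
  f zero                         ∎
  where open ≡-Reasoning
sumℚ-selectˡ {suc m} (suc i) f = begin
  0ℚ ℚ.* f zero ℚ.+ sumℚ (λ j → identityℚ (suc i) (suc j) ℚ.* f (suc j))
    ≡⟨ cong₂ ℚ._+_ (ℚP.*-zeroˡ (f zero)) (sumℚ-cong (λ j → cong (ℚ._* f (suc j)) (identityℚ-suc i j))) ⟩
  0ℚ ℚ.+ sumℚ (λ j → identityℚ i j ℚ.* f (suc j)) ≡⟨ ℚP.+-identityˡ _ ⟩
  sumℚ (λ j → identityℚ i j ℚ.* f (suc j))        ≡⟨ sumℚ-selectˡ i (λ j → f (suc j)) ⟩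
  f (suc i)                                         ∎
  where open ≡-Reasoning

sumℚ-selectʳ : ∀ {m} (i : Fin m) (f : Fin m → ℚ) → sumℚ (λ j → f j ℚ.* identityℚ j i) ≡ f i
sumℚ-selectʳ i f = trans
  (sumℚ-cong (λ j → trans (ℚP.*-comm (f j) (identityℚ j i)) (cong (ℚ._* f j) (identityℚ-sym j i))))
  (sumℚ-selectˡ i f)

infix 4 _≐_

_≐_ : ∀ {m} → Mat ℚ m → Mat ℚ m → Set
M ≐ N = ∀ i j → M i j ≡ N i j

≐-setoid : ℕ → Setoid 0ℓ 0ℓ
≐-setoid m = record
  { Carrier       = Mat ℚ m
  ; _≈_           = _≐_
  ; isEquivalence = record
    { refl  = λ _ _ → refl
    ; sym   = λ M≐N i j → sym (M≐N i j)
    ; trans = λ M≐N N≐L i j → trans (M≐N i j) (N≐L i j)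
    }
  }

·ℚ-congˡ : ∀ {m} (M : Mat ℚ m) {N N′ : Mat ℚ m} → N ≐ N′ → M ·ℚ N ≐ M ·ℚ N′
·ℚ-congˡ M N≐N′ i j = sumℚ-cong (λ l → cong (M i l ℚ.*_) (N≐N′ l j))

·ℚ-congʳ : ∀ {m} {M M′ : Mat ℚ m} → M ≐ M′ → (N : Mat ℚ m) → M ·ℚ N ≐ M′ ·ℚ N
·ℚ-congʳ M≐M′ N i j = sumℚ-cong (λ l → cong (ℚ._* N l j) (M≐M′ i l))

·ℚ-assoc : ∀ {m} (M N L : Mat ℚ m) → (M ·ℚ N) ·ℚ L ≐ M ·ℚ (N ·ℚ L)
·ℚ-assoc M N L i j = begin
  sumℚ (λ l → sumℚ (λ r → M i r ℚ.* N r l) ℚ.* L l j)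
    ≡⟨ sumℚ-cong (λ l → *-distribʳ-sumℚ (L l j) (λ r → M i r ℚ.* N r l)) ⟩
  sumℚ (λ l → sumℚ (λ r → (M i r ℚ.* N r l) ℚ.* L l j))
    ≡⟨ sumℚ-comm (λ l r → (M i r ℚ.* N r l) ℚ.* L l j) ⟩
  sumℚ (λ r → sumℚ (λ l → (M i r ℚ.* N r l) ℚ.* L l j))
    ≡⟨ sumℚ-cong (λ r → sumℚ-cong (λ l → ℚP.*-assoc (M i r) (N r l) (L l j))) ⟩
  sumℚ (λ r → sumℚ (λ l → M i r ℚ.* (N r l ℚ.* L l j)))
    ≡⟨ sumℚ-cong (λ r → *-distribˡ-sumℚ (M i r) (λ l → N r l ℚ.* L l j)) ⟨
  sumℚ (λ r → M i r ℚ.* sumℚ (λ l → N r l ℚ.* L l j)) ∎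
  where open ≡-Reasoning

·ℚ-identityˡ : ∀ {m} (M : Mat ℚ m) → identityℚ ·ℚ M ≐ M
·ℚ-identityˡ M i j = sumℚ-selectˡ i (λ l → M l j)

·ℚ-identityʳ : ∀ {m} (M : Mat ℚ m) → M ·ℚ identityℚ ≐ M
·ℚ-identityʳ M i j = sumℚ-selectʳ j (λ l → M i l)

transpose-·ℚ : ∀ {m} (M N : Mat ℚ m) → transpose (M ·ℚ N) ≐ transpose N ·ℚ transpose M
transpose-·ℚ M N i j = sumℚ-cong (λ l → ℚP.*-comm (M j l) (N l i))

-- Conjugation X ↦ A X A is injective when A has a two-sided inverse B,
-- since B (A X A) B = X.
conj-injective : ∀ {m} (A B : Mat ℚ m) → B ·ℚ A ≐ identityℚ → A ·ℚ B ≐ identityℚ →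
  ∀ X Y → (A ·ℚ X) ·ℚ A ≐ (A ·ℚ Y) ·ℚ A → X ≐ Y
conj-injective {m} A B BA≐I AB≐I X Y AXA≐AYA = begin
  X                               ≈⟨ uncover X ⟨
  (B ·ℚ ((A ·ℚ X) ·ℚ A)) ·ℚ B     ≈⟨ ·ℚ-congʳ (·ℚ-congˡ B AXA≐AYA) B ⟩
  (B ·ℚ ((A ·ℚ Y) ·ℚ A)) ·ℚ B     ≈⟨ uncover Y ⟩
  Y                               ∎
  where
  open SetoidReasoning (≐-setoid m)
  uncover : ∀ Z → (B ·ℚ ((A ·ℚ Z) ·ℚ A)) ·ℚ B ≐ Z
  uncover Z = begin
    (B ·ℚ ((A ·ℚ Z) ·ℚ A)) ·ℚ B     ≈⟨ ·ℚ-congʳ (·ℚ-assoc B (A ·ℚ Z) A) B ⟨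
    ((B ·ℚ (A ·ℚ Z)) ·ℚ A) ·ℚ B     ≈⟨ ·ℚ-congʳ (·ℚ-congʳ (·ℚ-assoc B A Z) A) B ⟨
    (((B ·ℚ A) ·ℚ Z) ·ℚ A) ·ℚ B     ≈⟨ ·ℚ-congʳ (·ℚ-congʳ (·ℚ-congʳ BA≐I Z) A) B ⟩
    ((identityℚ ·ℚ Z) ·ℚ A) ·ℚ B    ≈⟨ ·ℚ-congʳ (·ℚ-congʳ (·ℚ-identityˡ Z) A) B ⟩
    (Z ·ℚ A) ·ℚ B                   ≈⟨ ·ℚ-assoc Z A B ⟩
    Z ·ℚ (A ·ℚ B)                   ≈⟨ ·ℚ-congˡ Z AB≐I ⟩
    Z ·ℚ identityℚ                  ≈⟨ ·ℚ-identityʳ Z ⟩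
    Z                               ∎

transpose-conj : ∀ {m} (A : Mat ℚ m) → Symmetric A →
  ∀ X → transpose ((A ·ℚ X) ·ℚ A) ≐ (A ·ℚ transpose X) ·ℚ A
transpose-conj {m} A A-sym X = begin
  transpose ((A ·ℚ X) ·ℚ A)               ≈⟨ transpose-·ℚ (A ·ℚ X) A ⟩
  transpose A ·ℚ transpose (A ·ℚ X)       ≈⟨ ·ℚ-congʳ Aᵀ≐A (transpose (A ·ℚ X)) ⟩
  A ·ℚ transpose (A ·ℚ X)                 ≈⟨ ·ℚ-congˡ A (transpose-·ℚ A X) ⟩
  A ·ℚ (transpose X ·ℚ transpose A)       ≈⟨ ·ℚ-congˡ A (·ℚ-congˡ (transpose X) Aᵀ≐A) ⟩
  A ·ℚ (transpose X ·ℚ A)                 ≈⟨ ·ℚ-assoc A (transpose X) A ⟨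
  (A ·ℚ transpose X) ·ℚ A                 ∎
  where
  open SetoidReasoning (≐-setoid m)
  Aᵀ≐A : transpose A ≐ A
  Aᵀ≐A i j = A-sym j i

toℚ-· : ∀ {m} (M N : Mat ℕ m) → toℚ (M · N) ≐ toℚ M ·ℚ toℚ N
toℚ-· M N i j = trans (ι-sum (λ l → M i l ℕ.* N l j)) (sumℚ-cong (λ l → ι-* (M i l) (N l j)))
  where
  ι-sum : ∀ {m} (f : Fin m → ℕ) → ι (sumℕ f) ≡ sumℚ (λ i → ι (f i))
  ι-sum {zero}  f = refl
  ι-sum {suc m} f = trans (ι-+ (f zero) (sumℕ (λ i → f (suc i))))
    (cong (ι (f zero) ℚ.+_) (ι-sum (λ i → f (suc i))))

block : ∀ {k n} → Mat ℚ (k * n) → Fin k → Fin k → Mat ℚ n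
block M b d u v = M (combine b u) (combine d v)

combine-elim : ∀ k {n} (R : Fin (k * n) → Fin (k * n) → Set) →
  (∀ b u d v → R (combine b u) (combine d v)) → ∀ x y → R x y
combine-elim k {n} R R-blocks x y =
  subst₂ R (FinP.combine-remQuot {k} n x) (FinP.combine-remQuot {k} n y)
    (R-blocks (proj₁ (remQuot {k} n x)) (proj₂ (remQuot {k} n x))
              (proj₁ (remQuot {k} n y)) (proj₂ (remQuot {k} n y)))

blockEntry : ∀ {k n} → Mat ℕ n → Fin k × Fin n → Fin k × Fin n → ℕ
blockEntry A (b , u) (c , w) = if ⌊ b ≟ c ⌋ then A u w else 0

blockDiag-remQuot : ∀ k {n} (A : Mat ℕ n) x y →
  blockDiag k A x y ≡ blockEntry A (remQuot {k} n x) (remQuot {k} n y)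
blockDiag-remQuot k {n} A x y with remQuot {k} n x | remQuot {k} n y
... | _ , _ | _ , _ = refl

blockDiag-entry : ∀ k {n} (A : Mat ℕ n) b u c w →
  toℚ (blockDiag k A) (combine b u) (combine c w) ≡ identityℚ b c ℚ.* toℚ A u w
blockDiag-entry k A b u c w =
  trans (cong ι (trans (blockDiag-remQuot k A (combine b u) (combine c w))
                       (cong₂ (blockEntry A) (FinP.remQuot-combine b u) (FinP.remQuot-combine c w))))
        (ι-if (b ≟ c))
  where
  ι-if : ∀ {P : Set} (P? : Dec P) →
    ι (if ⌊ P? ⌋ then A u w else 0) ≡ (if ⌊ P? ⌋ then 1ℚ else 0ℚ) ℚ.* ι (A u w)
  ι-if (yes _) = sym (ℚP.*-identityˡ (ι (A u w)))
  ι-if (no _)  = sym (ℚP.*-zeroˡ (ι (A u w)))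

blockDiag-row : ∀ k {n} (A : Mat ℕ n) (b : Fin k) (u : Fin n) (g : Fin (k * n) → ℚ) →
  sumℚ (λ z → toℚ (blockDiag k A) (combine b u) z ℚ.* g z)
    ≡ sumℚ (λ w → toℚ A u w ℚ.* g (combine b w))
blockDiag-row k {n} A b u g = begin
  sumℚ (λ z → toℚ (blockDiag k A) (combine b u) z ℚ.* g z)
    ≡⟨ sumℚ-combine k n _ ⟩
  sumℚ {k} (λ c → sumℚ {n} (λ w → toℚ (blockDiag k A) (combine b u) (combine c w) ℚ.* g (combine c w)))
    ≡⟨ sumℚ-cong (λ c → sumℚ-cong (λ w → cong (ℚ._* g (combine c w)) (blockDiag-entry k A b u c w))) ⟩
  sumℚ {k} (λ c → sumℚ {n} (λ w → (identityℚ b c ℚ.* toℚ A u w) ℚ.* g (combine c w)))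
    ≡⟨ sumℚ-cong (λ c → trans (sumℚ-cong (λ w → ℚP.*-assoc (identityℚ b c) (toℚ A u w) (g (combine c w))))
                               (sym (*-distribˡ-sumℚ (identityℚ b c) (λ w → toℚ A u w ℚ.* g (combine c w))))) ⟩
  sumℚ {k} (λ c → identityℚ b c ℚ.* sumℚ {n} (λ w → toℚ A u w ℚ.* g (combine c w)))
    ≡⟨ sumℚ-selectˡ b (λ c → sumℚ (λ w → toℚ A u w ℚ.* g (combine c w))) ⟩
  sumℚ (λ w → toℚ A u w ℚ.* g (combine b w)) ∎
  where open ≡-Reasoning

blockDiag-col : ∀ k {n} (A : Mat ℕ n) (d : Fin k) (v : Fin n) (g : Fin (k * n) → ℚ) →
  sumℚ (λ z → g z ℚ.* toℚ (blockDiag k A) z (combine d v))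
    ≡ sumℚ (λ w → g (combine d w) ℚ.* toℚ A w v)
blockDiag-col k {n} A d v g = begin
  sumℚ (λ z → g z ℚ.* toℚ (blockDiag k A) z (combine d v))
    ≡⟨ sumℚ-combine k n _ ⟩
  sumℚ {k} (λ c → sumℚ {n} (λ w → g (combine c w) ℚ.* toℚ (blockDiag k A) (combine c w) (combine d v)))
    ≡⟨ sumℚ-cong (λ c → sumℚ-cong (λ w → cong (g (combine c w) ℚ.*_) (blockDiag-entry k A c w d v))) ⟩
  sumℚ {k} (λ c → sumℚ {n} (λ w → g (combine c w) ℚ.* (identityℚ c d ℚ.* toℚ A w v)))
    ≡⟨ sumℚ-cong (λ c → trans (sumℚ-cong (λ w → swap-last (g (combine c w)) (identityℚ c d) (toℚ A w v)))
                               (sym (*-distribʳ-sumℚ (identityℚ c d) (λ w → g (combine c w) ℚ.* toℚ A w v)))) ⟩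
  sumℚ {k} (λ c → sumℚ {n} (λ w → g (combine c w) ℚ.* toℚ A w v) ℚ.* identityℚ c d)
    ≡⟨ sumℚ-selectʳ d (λ c → sumℚ (λ w → g (combine c w) ℚ.* toℚ A w v)) ⟩
  sumℚ (λ w → g (combine d w) ℚ.* toℚ A w v) ∎
  where
  open ≡-Reasoning
  swap-last : ∀ x y z → x ℚ.* (y ℚ.* z) ≡ (x ℚ.* z) ℚ.* y
  swap-last x y z = trans (cong (x ℚ.*_) (ℚP.*-comm y z)) (sym (ℚP.*-assoc x z y))

block-conj : ∀ k {n} (A : Mat ℕ n) (M : Mat ℚ (k * n)) (b d : Fin k) →
  block ((toℚ (blockDiag k A) ·ℚ M) ·ℚ toℚ (blockDiag k A)) b d
    ≐ (toℚ A ·ℚ block M b d) ·ℚ toℚ A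
block-conj k A M b d u v =
  trans (blockDiag-col k A d v (λ z → (toℚ (blockDiag k A) ·ℚ M) (combine b u) z))
        (sumℚ-cong (λ w → cong (ℚ._* toℚ A w v) (blockDiag-row k A b u (λ z → M z (combine d w)))))

-- If A is symmetric and invertible and (I_k ⊗ A) M (I_k ⊗ A) is symmetric,
-- then M is symmetric: blockwise, A M_bd A = (A M_db A)ᵀ = A M_dbᵀ A.
conj-symmetric : ∀ k {n} (A : Mat ℕ n) → Symmetric A → Invertible A →
  (M : Mat ℚ (k * n)) → Symmetric ((toℚ (blockDiag k A) ·ℚ M) ·ℚ toℚ (blockDiag k A)) →
  Symmetric M
conj-symmetric k {n} A A-sym (B , AB≐I , BA≐I) M conj-sym =
  combine-elim k (λ x y → M x y ≡ M y x)
    (λ b u d v → conj-injective (toℚ A) B BA≐I AB≐I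
                   (block M b d) (transpose (block M d b)) (blocks-related b d) u v)
  where
  conj : Mat ℚ (k * n)
  conj = (toℚ (blockDiag k A) ·ℚ M) ·ℚ toℚ (blockDiag k A)
  blocks-related : ∀ b d →
    (toℚ A ·ℚ block M b d) ·ℚ toℚ A ≐ (toℚ A ·ℚ transpose (block M d b)) ·ℚ toℚ A
  blocks-related b d u v = begin
    ((toℚ A ·ℚ block M b d) ·ℚ toℚ A) u v  ≡⟨ block-conj k A M b d u v ⟨
    conj (combine b u) (combine d v)       ≡⟨ conj-sym (combine b u) (combine d v) ⟩
    conj (combine d v) (combine b u)       ≡⟨ block-conj k A M d b v u ⟩
    ((toℚ A ·ℚ block M d b) ·ℚ toℚ A) v u  ≡⟨ transpose-conj (toℚ A) (λ i j → cong ι (A-sym i j)) (block M d b) u v ⟩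
    ((toℚ A ·ℚ transpose (block M d b)) ·ℚ toℚ A) u v ∎
    where open ≡-Reasoning

-- A symmetric permutation matrix belongs to an involution: the entry
-- (p i, i) equals the entry (i, p i), which is 1.
symmetric⇒involution : ∀ {m} (p : Permutation′ m) → Symmetric (permMatrix p) →
  ∀ i → p ⟨$⟩ʳ (p ⟨$⟩ʳ i) ≡ i
symmetric⇒involution p P-sym i = entry-one (trans (sym (P-sym i (p ⟨$⟩ʳ i))) diagonal)
  where
  diagonal : permMatrix p i (p ⟨$⟩ʳ i) ≡ 1
  diagonal with (p ⟨$⟩ʳ i) ≟ (p ⟨$⟩ʳ i)
  ... | yes _   = refl
  ... | no  p≢p = ⊥-elim (p≢p refl)
  entry-one : ∀ {j} → permMatrix p (p ⟨$⟩ʳ i) j ≡ 1 → p ⟨$⟩ʳ (p ⟨$⟩ʳ i) ≡ j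
  entry-one {j} eq with (p ⟨$⟩ʳ (p ⟨$⟩ʳ i)) ≟ j
  ... | yes q = q
  entry-one () | no _

lemma3p5 : {n : ℕ} (H : Graph n) → Invertible (Graph.adj H) →
             (k : ℕ) → k ≥ 1 → (p : Permutation′ (k * n)) →
             Symmetric ((blockDiag k (Graph.adj H) · permMatrix p) · blockDiag k (Graph.adj H)) →
             Symmetric (permMatrix p) × (∀ i → p ⟨$⟩ʳ (p ⟨$⟩ʳ i) ≡ i)
lemma3p5 {n} H A-inv k _ p ÃPÃ-sym = P-sym , symmetric⇒involution p P-sym
  where
  Ã P : Mat ℕ (k * n)
  Ã = blockDiag k (Graph.adj H)
  P = permMatrix p
  toℚ-conj : toℚ ((Ã · P) · Ã) ≐ (toℚ Ã ·ℚ toℚ P) ·ℚ toℚ Ã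
  toℚ-conj i j = trans (toℚ-· (Ã · P) Ã i j) (·ℚ-congʳ (toℚ-· Ã P) (toℚ Ã) i j)
  conj-sym : Symmetric ((toℚ Ã ·ℚ toℚ P) ·ℚ toℚ Ã)
  conj-sym i j = trans (sym (toℚ-conj i j)) (trans (cong ι (ÃPÃ-sym i j)) (toℚ-conj j i))
  P-sym : Symmetric P
  P-sym i j = ι-injective _ _
    (conj-symmetric k (Graph.adj H) (Graph.adjSym H) A-inv (toℚ P) conj-sym i j)
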